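{- There exists a visibly pushdown game $\mathcal G$ with a \text{VLDL} winning condition such that Player 0 wins $\mathcal G$, but every winning strategy of Player 0 requires infinite memory (i.e., no winning strategy for Player 0 is implemented by a finite automaton with output). Similarly, there exists a visibly pushdown game $\mathcal G'$ with a \text{VLDL} winning condition such that Player 1 wins $\mathcal G'$, but every winning strategy of Player 1 requires infinite memory.
   Context: Let $P$ be a finite set of atomic propositions, $\Sigma=2^P$, and $\widetilde\Sigma=(\Sigma_c,\Sigma_r,\Sigma_l)$ a partition of $\Sigma$ into calls, returns, local actions. A visibly pushdown system (VPS) $\mathcal S=(Q,\widetilde\Sigma,\Gamma,\Delta)$ has finite $Q$, finite stack alphabet $\Gamma\ni\bot$, $\Delta \subseteq (Q\times\Sigma_c\times Q\times(\Gamma\setminus\{\bot\}))\cup(Q\times\Sigma_r\times\Gamma\times Q)\cup(Q\times\Sigma_l\times Q)$; configurations $(q,\gamma)$, $\gamma\in(\Gamma\setminus\{\bot\})^*\bot$; an $a$-labeled edge from $(q,\gamma)$ to $(q',\gamma')$ exists iff: $a\in\Sigma_c$, $(q,a,q',A)\in\Delta$, $\gamma'=A\gamma$; or $a\in\Sigma_r$, $(q,a,\bot,q')\in\Delta$, $\gamma=\gamma'=\bot$; or $a\in\Sigma_r$, $(q,a,A,q')\in\Delta$, $A\ne\bot$, $\gamma=A\gamma'$; or $a\in\Sigma_l$, $(q,a,q')\in\Delta$, $\gamma=\gamma'$. A VPA adds initial states $I$ and final states $F$; a finite run is initial if it starts in $(q,\bot)$, $q\in I$, accepting if it ends in $F$.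 \text{VLDL}: a testing VPA (TVPA) is a VPA with a function $t$ from states to \text{VLDL} formulas (acyclic nesting; default tautology). Formulas: $\varphi ::= p \mid \neg\varphi\mid\varphi\wedge\varphi\mid\varphi\vee\varphi\mid\langle\mathfrak B\rangle\varphi\mid[\mathfrak B]\varphi$, $p\in P$. For $\alpha\in\Sigma^\omega$: $(\alpha,k)\models p$ iff $p\in\alpha_k$; $\mathcal R_{\mathfrak B}(\alpha)$ is the set of $(k,l)$ such that some initial accepting run $(q_k,\sigma_k)\cdots(q_l,\sigma_l)$ of $\mathfrak B$ on $\alpha_k\cdots\alpha_{l-1}$ satisfies $(\alpha,m)\models t(q_m)$ for all $m$; $\langle\mathfrak B\rangle\varphi$ holds at $k$ iff some $l\ge k$ with $(k,l)\in\mathcal R_{\mathfrak B}(\alpha)$ has $(\alpha,l)\models\varphi$; $[\mathfrak B]\varphi$ holds at $k$ iff all such $l$ satisfy $\varphi$. Games: a two-player game $(V_0,V_1,\Sigma,E,v_I,\ell,\varphi)$ has disjoint, at most countable vertex sets $V_0,V_1$ ($V=V_0\cup V_1$), edges $E\subseteq V\times V$, initial vertex $v_I$, labeling $\ell:V\to\Sigma$, and a \text{VLDL} formula $\varphi$. A play is an infinite path $v_0v_1\cdots$; it is initial if $v_0=v_I$, won by Player 0 iff $\ell(v_1)\ell(v_2)\cdots$ satisfies $\varphi$ at position 0, otherwise by Player 1. A strategy for Player $i$ is $\sigma:V^*V_i\to V$ with $(v,\sigma(wv))\in E$; it is winning if all initial plays consistent with it are won by Player $i$; a player wins if she has a winning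 strategy. A visibly pushdown game with \text{VLDL} winning condition is a tuple $(\mathcal S,Q_0,Q_1,q_I,\varphi)$ consisting of a VPS $\mathcal S$, a partition $Q=Q_0\cup Q_1$, initial state $q_I$ and a \text{VLDL} formula $\varphi$; it induces the game with $V_i=Q_i\times((\Gamma\setminus\{\bot\})^*\bot)\times\Sigma$, $v_I=(q_I,\bot,a)$ for some $a\in\Sigma$, an edge from $(q,\gamma,a)$ to $(q',\gamma',a')$ iff there is an $a'$-labeled edge from $(q,\gamma)$ to $(q',\gamma')$ in the configuration graph of $\mathcal S$, and $\ell(q,\gamma,a)=a$. A strategy is implemented by a finite automaton with output (finite memory) if there is a finite-state transducer reading the play prefix and outputting the strategy's chosen successor. -}

module Defs where

open import Data.Nat using (ℕ; zero; suc; _≤_; _<_)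
open import Data.Fin using (Fin)
open import Data.Fin.Subset using (Subset; _∈_)
open import Data.Bool using (Bool; true; false)
open import Data.List using (List; []; _∷_; foldl; _∷ʳ_)
open import Data.Maybe using (Maybe; just; nothing)
open import Data.Product using (Σ; _×_; _,_; proj₁; proj₂)
open import Data.Sum using (_⊎_)
open import Relation.Binary.PropositionalEquality using (_≡_)
open import Relation.Nullary using (¬_)

-- Alphabet: P = Fin n, Σ = 2^P = Subset n.
-- The partition (Σc, Σr, Σl) of Σ is given by a function kind : Σ → Kind.

Letter : ℕ → Set
Letter n = Subset n

data Kind : Set where
  call ret loc : Kind

-- Q = Fin nQ;  Γ \ {⊥} = Fin nΓ;  Γ = Maybe (Fin nΓ) with nothing = ⊥.

record VPS (n : ℕ) (kind : Letter n → Kind) : Set where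
  field
    nQ : ℕ
    nΓ : ℕ
    Δc : Fin nQ → Letter n → Fin nQ → Fin nΓ → Bool
    Δr : Fin nQ → Letter n → Maybe (Fin nΓ) → Fin nQ → Bool
    Δl : Fin nQ → Letter n → Fin nQ → Bool

-- configuration (q , γ) ; the stack γ ∈ (Γ\{⊥})* ⊥ is represented by
-- the list of its non-bottom symbols (the ⊥ at the bottom is implicit).
Config : ∀ {n kind} → VPS n kind → Set
Config S = Fin (VPS.nQ S) × List (Fin (VPS.nΓ S))

data Step {n : ℕ} {kind : Letter n → Kind} (S : VPS n kind) :
          Config S → Letter n → Config S → Set where
  stepCall   : ∀ {q a q' A γ} → kind a ≡ call →
               VPS.Δc S q a q' A ≡ true → Step S (q , γ) a (q' , A ∷ γ)
  stepRetBot : ∀ {q a q'} → kind a ≡ ret →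
               VPS.Δr S q a nothing q' ≡ true → Step S (q , []) a (q' , [])
  stepRet    : ∀ {q a A q' γ} → kind a ≡ ret →
               VPS.Δr S q a (just A) q' ≡ true → Step S (q , A ∷ γ) a (q' , γ)
  stepLoc    : ∀ {q a q' γ} → kind a ≡ loc →
               VPS.Δl S q a q' ≡ true → Step S (q , γ) a (q' , γ)

-- VLDL formulas and testing VPAs (mutually inductive; acyclic nesting
-- is automatic by well-foundedness of the inductive types).

mutual
  data Formula (n : ℕ) (kind : Letter n → Kind) : Set where
    atom : Fin n → Formula n kind
    neg  : Formula n kind → Formula n kind
    and  : Formula n kind → Formula n kind → Formula n kind
    or   : Formula n kind → Formula n kind → Formula n kind
    dia  : TVPA n kind → Formula n kind → Formula n kind
    box  : TVPA n kind → Formula n kind → Formula n kind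

  data TVPA (n : ℕ) (kind : Letter n → Kind) : Set where
    mkTVPA : (S : VPS n kind) →
             (I F : Fin (VPS.nQ S) → Bool) →
             (t : Fin (VPS.nQ S) → Formula n kind) →
             TVPA n kind

-- an initial accepting run (q_k,σ_k)⋯(q_l,σ_l) of the VPA on α_k⋯α_{l-1}
-- whose states satisfy the tests: test q m  means  (α , m) ⊨ t(q).
AccRun : ∀ {n kind} (S : VPS n kind) (I F : Fin (VPS.nQ S) → Bool)
         (test : Fin (VPS.nQ S) → ℕ → Set) (α : ℕ → Letter n) (k l : ℕ) → Set
AccRun S I F test α k l =
  Σ (ℕ → Config S) λ c →
    (I (proj₁ (c k)) ≡ true) ×
    (proj₂ (c k) ≡ []) ×
    (F (proj₁ (c l)) ≡ true) ×
    (∀ m → k ≤ m → m < l → Step S (c m) (α m) (c (suc m))) ×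
    (∀ m → k ≤ m → m ≤ l → test (proj₁ (c m)) m)

Sat : ∀ {n kind} → (ℕ → Letter n) → ℕ → Formula n kind → Set
Sat α k (atom p) = p ∈ α k
Sat α k (neg φ) = ¬ Sat α k φ
Sat α k (and φ ψ) = Sat α k φ × Sat α k ψ
Sat α k (or φ ψ) = Sat α k φ ⊎ Sat α k ψ
Sat α k (dia (mkTVPA S I F t) φ) =
  Σ ℕ λ l → (k ≤ l) × AccRun S I F (λ q m → Sat α m (t q)) α k l × Sat α l φ
Sat α k (box (mkTVPA S I F t) φ) =
  ∀ l → k ≤ l → AccRun S I F (λ q m → Sat α m (t q)) α k l → Sat α l φ

data Player : Set where
  P0 P1 : Player

record VPGame (n : ℕ) (kind : Letter n → Kind) : Set where
  field
    S     : VPS n kind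
    owner : Fin (VPS.nQ S) → Player
    qI    : Fin (VPS.nQ S)
    aI    : Letter n
    φ     : Formula n kind

module _ {n : ℕ} {kind : Letter n → Kind} (G : VPGame n kind) where
  open VPGame G

  Vertex : Set
  Vertex = Fin (VPS.nQ S) × List (Fin (VPS.nΓ S)) × Letter n

  vOwner : Vertex → Player
  vOwner (q , _ , _) = owner q

  label : Vertex → Letter n
  label (_ , _ , a) = a

  vI : Vertex
  vI = (qI , [] , aI)

  Edge : Vertex → Vertex → Set
  Edge (q , γ , _) (q' , γ' , a') = Step S (q , γ) a' (q' , γ')

  -- strategy σ : V* V_i → V, given as a function of (history w , last vertex v);
  -- only its values for v ∈ V_i are relevant.
  record Strategy (i : Player) : Set where
    field
      next  : List Vertex → Vertex → Vertex
      legal : ∀ w v → vOwner v ≡ i → Edge v (next w v)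
  open Strategy public

  prefix : (ℕ → Vertex) → ℕ → List Vertex
  prefix ρ zero = []
  prefix ρ (suc m) = prefix ρ m ∷ʳ ρ m

  InitialPlay : (ℕ → Vertex) → Set
  InitialPlay ρ = (ρ 0 ≡ vI) × (∀ m → Edge (ρ m) (ρ (suc m)))

  ConsistentWith : {i : Player} → Strategy i → (ℕ → Vertex) → Set
  ConsistentWith {i} σ ρ =
    ∀ m → vOwner (ρ m) ≡ i → ρ (suc m) ≡ next σ (prefix ρ m) (ρ m)

  WonBy : Player → (ℕ → Vertex) → Set
  WonBy P0 ρ = Sat (λ m → label (ρ (suc m))) 0 φ
  WonBy P1 ρ = ¬ Sat (λ m → label (ρ (suc m))) 0 φ

  Winning : {i : Player} → Strategy i → Set
  Winning {i} σ = ∀ ρ → InitialPlay ρ → ConsistentWith σ ρ → WonBy i ρ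

  Wins : Player → Set
  Wins i = Σ (Strategy i) Winning

  -- σ is implemented by a finite automaton with output (Mealy machine with
  -- memory states Fin m): after reading the history w the memory is
  -- foldl upd init w, and the chosen successor of v ∈ V_i is out mem v.
  FiniteMemory : {i : Player} → Strategy i → Set
  FiniteMemory {i} σ =
    Σ ℕ λ m → Σ (Fin m) λ init →
    Σ (Fin m → Vertex → Fin m) λ upd →
    Σ (Fin m → Vertex → Vertex) λ out →
      ∀ w v → vOwner v ≡ i → next σ w v ≡ out (foldl upd init w) v

WinsOnlyWithInfiniteMemory : ∀ {n kind} → VPGame n kind → Player → Set
WinsOnlyWithInfiniteMemory G i =
  Wins G i × (∀ (σ : Strategy G i) → Winning G σ → ¬ FiniteMemory G σ)

module Submission where

-- For each player i we build one game, 'game i', over three propositions.  The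
-- opponent of Player i pushes j plain calls, a marked call and p plain calls, then pops
-- some returns and asks a question; Player i must answer "yes" iff the marked call is still
-- on the stack.  The arena's stack has a single symbol, so the current vertex shows only the
-- stack height; the winning condition is "no mistake" (for P1) or "not a mistake" (for P0),
-- where 'mistake' is ⟨monitor⟩true for a deterministic VPA that marks the marked call on its
-- own stack and rejects wrong answers.
--
-- Then the game is defined; simulating the
-- monitor on the history gives a winning strategy ('answering-wins').  Conversely, a
-- finite-memory strategy with 'size' memory states is fooled by pigeonhole: two of the
-- size + 1 openings of equal height reach the same memory state, so the strategy answers
-- two probes alike although the mark is pending in one and popped in the other
-- ('FiniteMemoryLoses').

open import Defs
open import Data.Nat using (ℕ; zero; suc; _+_; _∸_; _<_; _≤_; z≤n)
open import Data.Nat.Properties using (+-suc; +-cancelʳ-≡; m∸n+n≡m; m≤n⇒∃[o]m+o≡n; n≤1+n; ≤-trans; ≤-refl; n<1+n)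
open import Data.Nat.Tactic.RingSolver using (solve-∀)
open import Data.Fin using (Fin; zero; suc; toℕ; _≟_)
open import Data.Fin.Properties using (*↔×; pigeonhole; toℕ≤pred[n])
open import Data.Bool using (Bool; true; false; if_then_else_)
open import Data.List using (List; []; _∷_; _++_; _∷ʳ_; foldl; map; replicate; length; drop)
open import Data.List.Properties using (foldl-++; foldl-∷ʳ; map-++; ++-assoc; ++-identityʳ; ∷-injectiveʳ)
open import Data.List.Relation.Unary.All using (All; []; _∷_)
open import Data.List.Relation.Unary.All.Properties using (++⁺; replicate⁺)
open import Data.Vec using ([]; _∷_)
open import Data.Maybe using (Maybe; just; nothing)
open import Data.Product using (Σ; ∃; _×_; _,_; proj₁; proj₂)
open import Data.Product.Properties using (≡-dec)
open import Data.Sum using (_⊎_; inj₁; inj₂)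
open import Data.Empty using (⊥; ⊥-elim)
open import Function.Bundles using (_↔_; Inverse)
open import Function.Construct.Identity using (↔-id)
open import Relation.Binary.PropositionalEquality
open import Relation.Nullary using (¬_; Dec; yes; no; does)
open import Relation.Nullary.Decidable using (dec-true)

firsts : {A : Set} → (ℕ → A) → ℕ → List A
firsts α zero = []
firsts α (suc m) = α 0 ∷ firsts (λ k → α (suc k)) m

firsts-snoc : {A : Set} (α : ℕ → A) (m : ℕ) → firsts α (suc m) ≡ firsts α m ∷ʳ α m
firsts-snoc α zero = refl
firsts-snoc α (suc m) = cong (α 0 ∷_) (firsts-snoc (λ k → α (suc k)) m)

padded : {A : Set} → A → List A → ℕ → A
padded d [] _ = d
padded d (x ∷ u) zero = x
padded d (x ∷ u) (suc k) = padded d u k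

firsts-padded : {A : Set} (d : A) (u : List A) → firsts (padded d u) (length u) ≡ u
firsts-padded d [] = refl
firsts-padded d (x ∷ u) = cong (x ∷_) (firsts-padded d u)

replicate-shift : {A : Set} (k : ℕ) (x : A) (ys : List A) → replicate k x ++ x ∷ ys ≡ x ∷ replicate k x ++ ys
replicate-shift zero x ys = refl
replicate-shift (suc k) x ys = cong (x ∷_) (replicate-shift k x ys)

replicate-+ : {A : Set} (k l : ℕ) (x : A) → replicate (k + l) x ≡ replicate k x ++ replicate l x
replicate-+ zero l x = refl
replicate-+ (suc k) l x = cong (x ∷_) (replicate-+ k l x)

module Repeat {S Λ A : Set} (δ : S × List A → Λ → S × List A) where

  repeat-push : ∀ {s a} {A₀ : A} → (∀ γ → δ (s , γ) a ≡ (s , A₀ ∷ γ)) →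
                ∀ j γ → foldl δ (s , γ) (replicate j a) ≡ (s , replicate j A₀ ++ γ)
  repeat-push pushes zero γ = refl
  repeat-push {s} {a} {A₀} pushes (suc j) γ = begin
      foldl δ (δ (s , γ) a) (replicate j a)   ≡⟨ cong (λ c → foldl δ c (replicate j a)) (pushes γ) ⟩
      foldl δ (s , A₀ ∷ γ) (replicate j a)    ≡⟨ repeat-push pushes j (A₀ ∷ γ) ⟩
      (s , replicate j A₀ ++ A₀ ∷ γ)          ≡⟨ cong (s ,_) (replicate-shift j A₀ γ) ⟩
      (s , A₀ ∷ replicate j A₀ ++ γ)          ∎
    where open ≡-Reasoning

  repeat-pop : ∀ {s a} {A₀ : A} → (∀ γ → δ (s , A₀ ∷ γ) a ≡ (s , γ)) →
               ∀ j γ rest → foldl δ (s , replicate j A₀ ++ γ) (replicate j a ++ rest) ≡ foldl δ (s , γ) rest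
  repeat-pop pops zero γ rest = refl
  repeat-pop {s} {a} {A₀} pops (suc j) γ rest =
    trans (cong (λ c → foldl δ c (replicate j a ++ rest)) (pops (replicate j A₀ ++ γ))) (repeat-pop pops j γ rest)

decided : {P : Set} (d : Dec P) → does d ≡ true → P
decided (yes p) _ = p

-- On returns, 'next' sees the popped
-- symbol (nothing when the stack is empty); on calls and local actions it sees nothing.
module Deterministic {n : ℕ} (kind : Letter n → Kind) {State : Set} {nQ nΓ : ℕ}
    (index : Fin nQ ↔ State)
    (next : State → Letter n → Maybe (Fin nΓ) → State)
    (push : State → Letter n → Fin nΓ) where

  open Inverse index using (to; from; strictlyInverseˡ)

  Cfg : Set
  Cfg = State × List (Fin nΓ)

  move : Kind → Cfg → Letter n → Cfg
  move call (s , γ) a = next s a nothing , push s a ∷ γ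
  move ret (s , []) a = next s a nothing , []
  move ret (s , A ∷ γ) a = next s a (just A) , γ
  move loc (s , γ) a = next s a nothing , γ

  δ : Cfg → Letter n → Cfg
  δ c a = move (kind a) c a

  vps : VPS n kind
  vps = record
    { nQ = nQ ; nΓ = nΓ
    ; Δc = λ q a q' A → does (≡-dec _≟_ _≟_ (q' , A) (from (next (to q) a nothing) , push (to q) a))
    ; Δr = λ q a t q' → does (q' ≟ from (next (to q) a t))
    ; Δl = λ q a q' → does (q' ≟ from (next (to q) a nothing)) }

  encode : Cfg → Config vps
  encode (s , γ) = from s , γ

  step : ∀ c a → Step vps (encode c) a (encode (δ c a))
  step c a = stepAt (kind a) refl c
    where
    taken : ∀ s t → does (from (next s a t) ≟ from (next (to (from s)) a t)) ≡ true
    taken s t = dec-true (_ ≟ _) (cong (λ s' → from (next s' a t)) (sym (strictlyInverseˡ s)))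
    stepAt : ∀ k → kind a ≡ k → ∀ c → Step vps (encode c) a (encode (δ c a))
    stepAt call e (s , γ) rewrite e = stepCall e (dec-true (≡-dec _≟_ _≟_ _ _)
      (cong (λ s' → from (next s' a nothing) , push s' a) (sym (strictlyInverseˡ s))))
    stepAt ret e (s , []) rewrite e = stepRetBot e (taken s nothing)
    stepAt ret e (s , A ∷ γ) rewrite e = stepRet e (taken s (just A))
    stepAt loc e (s , γ) rewrite e = stepLoc e (taken s nothing)

  step-det : ∀ {c a c'} → Step vps (encode c) a c' → c' ≡ encode (δ c a)
  step-det {s , γ} {a} (stepCall {q' = q'} {A = A} e d) rewrite e
    with refl ← decided (≡-dec _≟_ _≟_ (q' , A) _) d rewrite strictlyInverseˡ s = refl
  step-det {s , []} {a} (stepRetBot {q' = q'} e d) rewrite e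
    with refl ← decided (q' ≟ _) d rewrite strictlyInverseˡ s = refl
  step-det {s , A ∷ γ} {a} (stepRet {q' = q'} e d) rewrite e
    with refl ← decided (q' ≟ _) d rewrite strictlyInverseˡ s = refl
  step-det {s , γ} {a} (stepLoc {q' = q'} e d) rewrite e
    with refl ← decided (q' ≟ _) d rewrite strictlyInverseˡ s = refl

  δ-state : ∀ c a → ∃ λ t → proj₁ (δ c a) ≡ next (proj₁ c) a t
  δ-state c a = stateOf (kind a) c
    where
    stateOf : ∀ k c → ∃ λ t → proj₁ (move k c a) ≡ next (proj₁ c) a t
    stateOf call (s , γ) = nothing , refl
    stateOf ret (s , []) = nothing , refl
    stateOf ret (s , A ∷ γ) = just A , refl
    stateOf loc (s , γ) = nothing , refl

  module Acceptance (start : State) (accept : State → Bool) where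

    initial final : Fin nQ → Bool
    initial q = does (q ≟ from start)
    final q = accept (to q)

    run : (ℕ → Letter n) → ℕ → Cfg
    run α zero = start , []
    run α (suc m) = δ (run α m) (α m)

    run-firsts : ∀ α m → run α m ≡ foldl δ (start , []) (firsts α m)
    run-firsts α zero = refl
    run-firsts α (suc m) = begin
      δ (run α m) (α m)                                 ≡⟨ cong (λ c → δ c (α m)) (run-firsts α m) ⟩
      δ (foldl δ (start , []) (firsts α m)) (α m)       ≡⟨ sym (foldl-∷ʳ δ _ (α m) (firsts α m)) ⟩
      foldl δ (start , []) (firsts α m ∷ʳ α m)          ≡⟨ cong (foldl δ (start , [])) (sym (firsts-snoc α m)) ⟩
      foldl δ (start , []) (firsts α (suc m))           ∎
      where open ≡-Reasoning

    run-accepts : ∀ (test : Fin nQ → ℕ → Set) → (∀ q m → test q m) →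
                  ∀ α l → accept (proj₁ (run α l)) ≡ true → AccRun vps initial final test α 0 l
    run-accepts test tests α l acc =
      (λ m → encode (run α m)) , dec-true (from start ≟ from start) refl , refl ,
      subst (λ s → accept s ≡ true) (sym (strictlyInverseˡ _)) acc ,
      (λ m _ _ → step (run α m) (α m)) , (λ m _ _ → tests _ m)

    -- Conversely, an accepting run from 0 to l can only be the run on α, which is therefore
    -- accepting.
    accepting-run : ∀ {test α l} → AccRun vps initial final test α 0 l → accept (proj₁ (run α l)) ≡ true
    accepting-run {α = α} {l = l} (c , c₀-initial , c₀-empty , c-final , c-steps , _) =
      subst (λ s → accept s ≡ true) (strictlyInverseˡ (proj₁ (run α l)))
            (subst (λ q → final q ≡ true) (cong proj₁ (follows l ≤-refl)) c-final)
      where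
      follows : ∀ m → m ≤ l → c m ≡ encode (run α m)
      follows zero _ = cong₂ _,_ (decided (_ ≟ _) c₀-initial) c₀-empty
      follows (suc m) m<l =
        step-det (subst (λ c' → Step vps c' (α m) (c (suc m))) (follows m m≤l) (c-steps m z≤n m<l))
        where m≤l = ≤-trans (n≤1+n m) m<l

_≟ᴾ_ : (i j : Player) → Dec (i ≡ j)
P0 ≟ᴾ P0 = yes refl
P0 ≟ᴾ P1 = no λ ()
P1 ≟ᴾ P0 = no λ ()
P1 ≟ᴾ P1 = yes refl

prefix-labels : ∀ {n kind} (G : VPGame n kind) (ρ : ℕ → Vertex G) (m : ℕ) →
                map (label G) (prefix G ρ (suc m)) ≡ label G (ρ 0) ∷ firsts (λ k → label G (ρ (suc k))) m
prefix-labels G ρ zero = refl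
prefix-labels G ρ (suc m) = begin
    map (label G) (prefix G ρ (suc m) ∷ʳ ρ (suc m))
  ≡⟨ map-++ (label G) (prefix G ρ (suc m)) _ ⟩
    map (label G) (prefix G ρ (suc m)) ∷ʳ α m
  ≡⟨ cong (_∷ʳ α m) (prefix-labels G ρ m) ⟩
    label G (ρ 0) ∷ (firsts α m ∷ʳ α m)
  ≡⟨ cong (label G (ρ 0) ∷_) (sym (firsts-snoc α m)) ⟩
    label G (ρ 0) ∷ firsts α (suc m)
  ∎
  where
  open ≡-Reasoning
  α : ℕ → _
  α k = label G (ρ (suc k))

-- The play in which Player i follows σ and the opponent reads its moves off a script of
-- letters: at an opponent vertex, the m-th move is 'env (script m)'.
module Outcome {n kind} (G : VPGame n kind) {i : Player} (σ : Strategy G i)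
    (env : Letter n → Vertex G → Vertex G)
    (env-legal : ∀ a v → ¬ vOwner G v ≡ i → Edge G v (env a v)) where

  Position : Set
  Position = List (Vertex G) × Vertex G

  choose : List (Vertex G) → Vertex G → Letter n → Vertex G
  choose w v a with vOwner G v ≟ᴾ i
  ... | yes _ = next σ w v
  ... | no _ = env a v

  advance : Position → Letter n → Position
  advance (w , v) a = w ∷ʳ v , choose w v a

  advance-σ : ∀ {w v} a → vOwner G v ≡ i → advance (w , v) a ≡ (w ∷ʳ v , next σ w v)
  advance-σ {w} {v} a owned with vOwner G v ≟ᴾ i
  ... | yes _ = refl
  ... | no notOwned = ⊥-elim (notOwned owned)

  advance-env : ∀ {w v} a → ¬ vOwner G v ≡ i → advance (w , v) a ≡ (w ∷ʳ v , env a v)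
  advance-env {w} {v} a notOwned with vOwner G v ≟ᴾ i
  ... | yes owned = ⊥-elim (notOwned owned)
  ... | no _ = refl

  position : (ℕ → Letter n) → ℕ → Position
  position script m = foldl advance ([] , vI G) (firsts script m)

  play : (ℕ → Letter n) → ℕ → Vertex G
  play script m = proj₂ (position script m)

  position-suc : ∀ script m → position script (suc m) ≡ advance (position script m) (script m)
  position-suc script m =
    trans (cong (foldl advance ([] , vI G)) (firsts-snoc script m)) (foldl-∷ʳ advance _ (script m) (firsts script m))

  history-is-prefix : ∀ script m → proj₁ (position script m) ≡ prefix G (play script) m
  history-is-prefix script zero = refl
  history-is-prefix script (suc m) =
    trans (cong proj₁ (position-suc script m)) (cong (_∷ʳ play script m) (history-is-prefix script m))

  play-initial : ∀ script → InitialPlay G (play script)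
  play-initial script = refl , λ m → subst (Edge G (play script m)) (sym (cong proj₂ (position-suc script m)))
                                           (chosen-edge (proj₁ (position script m)) (play script m) (script m))
    where
    chosen-edge : ∀ w v a → Edge G v (choose w v a)
    chosen-edge w v a with vOwner G v ≟ᴾ i
    ... | yes owned = legal σ w v owned
    ... | no notOwned = env-legal a v notOwned

  play-consistent : ∀ script → ConsistentWith G σ (play script)
  play-consistent script m owned = begin
      play script (suc m)
    ≡⟨ cong proj₂ (position-suc script m) ⟩
      proj₂ (advance (position script m) (script m))
    ≡⟨ cong proj₂ (advance-σ (script m) owned) ⟩
      next σ (proj₁ (position script m)) (play script m)
    ≡⟨ cong (λ w → next σ w (play script m)) (history-is-prefix script m) ⟩
      next σ (prefix G (play script) m) (play script m)
    ∎
    where open ≡-Reasoning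

  play-won : Winning G σ → ∀ script → WonBy G i (play script)
  play-won winning script = winning (play script) (play-initial script) (play-consistent script)

L : Set
L = Letter 3

kind₃ : L → Kind
kind₃ (true ∷ _ ∷ _ ∷ []) = loc
kind₃ (false ∷ true ∷ _ ∷ []) = ret
kind₃ (false ∷ false ∷ _ ∷ []) = call

-- plain call, marked call, return, question, answer "yes", any other local action
lc lm lr lq ly le : L
lc = false ∷ false ∷ false ∷ []
lm = false ∷ false ∷ true ∷ []
lr = false ∷ true ∷ false ∷ []
lq = true ∷ false ∷ false ∷ []
ly = true ∷ false ∷ true ∷ []
le = true ∷ true ∷ false ∷ []

isMark isQuestion isYes : L → Bool
isMark (false ∷ false ∷ true ∷ []) = true
isMark _ = false
isQuestion (true ∷ false ∷ false ∷ []) = true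
isQuestion _ = false
isYes (true ∷ false ∷ true ∷ []) = true
isYes _ = false

-- The opponent plays calls, returns and local actions; the first
-- marked call 'lm' opens the mark, a later question 'lq' hands the move to the answering
-- player, whose answer ends the interesting part of the play.
Phase : Set
Phase = Fin 4

pattern unmarked = zero
pattern marked = suc zero
pattern asking = suc (suc zero)
pattern answered = suc (suc (suc zero))

nextPhase : Phase → L → Phase
nextPhase unmarked a = if isMark a then marked else unmarked
nextPhase marked a = if isQuestion a then asking else marked
nextPhase asking _ = answered
nextPhase answered _ = answered

-- The arena has a single stack symbol: a vertex shows the stack height, but not where the
-- marked call lies in the stack.
module Arena = Deterministic kind₃ {nΓ = 1} (↔-id Phase) (λ p a _ → nextPhase p a) (λ _ _ → zero)

-- The monitor runs the arena's phases together with a flag, and marks the marked call on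
-- its own stack.  The flag records whether the mark is still pending, has been popped, or
-- whether a wrong answer was given ("yes" is right iff the mark is pending).
Flag : Set
Flag = Fin 3

pattern pending = zero
pattern popped = suc zero
pattern wrong = suc (suc zero)

Symbol : Set
Symbol = Fin 2

pattern plain = zero
pattern mark = suc zero

verdict : Flag → Bool → Flag
verdict pending true = pending
verdict pending false = wrong
verdict popped true = wrong
verdict popped false = popped
verdict wrong _ = wrong

afterReturn : Maybe Symbol → Flag → Flag
afterReturn (just mark) _ = popped
afterReturn _ f = f

nextFlag : Phase → Flag → L → Maybe Symbol → Flag
nextFlag asking f a _ = verdict f (isYes a)
nextFlag _ f _ t = afterReturn t f

monitorNext : Phase × Flag → L → Maybe Symbol → Phase × Flag
monitorNext (p , f) a t = nextPhase p a , nextFlag p f a t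

monitorPush : Phase × Flag → L → Symbol
monitorPush (unmarked , _) a = if isMark a then mark else plain
monitorPush _ _ = plain

isWrong : Phase × Flag → Bool
isWrong (_ , wrong) = true
isWrong _ = false

module Monitor = Deterministic kind₃ *↔× monitorNext monitorPush
module MonitorRun = Monitor.Acceptance (unmarked , pending) isWrong

monitorStart : Monitor.Cfg
monitorStart = (unmarked , pending) , []

truth : Formula 3 kind₃
truth = neg (and (atom zero) (neg (atom zero)))

truth-holds : ∀ α k → Sat α k truth
truth-holds α k (p , ¬p) = ¬p p

-- ⟨monitor⟩ truth: some prefix of the word drives the monitor to a wrong verdict.
mistake : Formula 3 kind₃
mistake = dia (mkTVPA Monitor.vps MonitorRun.initial MonitorRun.final (λ _ → truth)) truth

other : Player → Player
other P0 = P1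
other P1 = P0

owner : Player → Phase → Player
owner i asking = i
owner i _ = other i

objective : Player → Formula 3 kind₃
objective P0 = neg mistake
objective P1 = mistake

game : Player → VPGame 3 kind₃
game i = record { S = Arena.vps ; owner = owner i ; qI = unmarked ; aI = le ; φ = objective i }

Vtx : Set
Vtx = Phase × List (Fin 1) × L

letterOf : Vtx → L
letterOf (_ , _ , a) = a

word : (ℕ → Vtx) → ℕ → L
word ρ k = letterOf (ρ (suc k))

wins-without-mistake : ∀ i ρ → ¬ Sat (word ρ) 0 mistake → WonBy (game i) i ρ
wins-without-mistake P0 ρ ok = ok
wins-without-mistake P1 ρ ok = ok

wins-only-without-mistake : ∀ i ρ → WonBy (game i) i ρ → ¬ Sat (word ρ) 0 mistake
wins-only-without-mistake P0 ρ ok = ok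
wins-only-without-mistake P1 ρ ok = ok

other-differs : ∀ i → ¬ other i ≡ i
other-differs P0 ()
other-differs P1 ()

owned-is-asking : ∀ i p → owner i p ≡ i → p ≡ asking
owned-is-asking i asking _ = refl
owned-is-asking i unmarked owned = ⊥-elim (other-differs i owned)
owned-is-asking i marked owned = ⊥-elim (other-differs i owned)
owned-is-asking i answered owned = ⊥-elim (other-differs i owned)

arenaMove : L → Vtx → Vtx
arenaMove a (p , γ , _) = proj₁ (Arena.δ (p , γ) a) , proj₂ (Arena.δ (p , γ) a) , a

-- Every letter can be read at every vertex, so arena moves are always edges.
arenaMove-legal : ∀ i a v → Edge (game i) v (arenaMove a v)
arenaMove-legal i a (p , γ , _) = Arena.step (p , γ) a

flagAfter : List L → Flag
flagAfter u = proj₂ (proj₁ (foldl Monitor.δ monitorStart u))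

answer : Flag → L
answer pending = ly
answer _ = le

answer-right : ∀ f → ¬ f ≡ wrong → ¬ verdict f (isYes (answer f)) ≡ wrong
answer-right pending _ ()
answer-right popped _ ()
answer-right wrong f≢wrong _ = f≢wrong refl

afterReturn-right : ∀ t {f} → ¬ f ≡ wrong → ¬ afterReturn t f ≡ wrong
afterReturn-right (just mark) _ ()
afterReturn-right (just plain) f≢wrong = f≢wrong
afterReturn-right nothing f≢wrong = f≢wrong

nextFlag-right : ∀ p f a t → ¬ f ≡ wrong → (p ≡ asking → a ≡ answer f) → ¬ nextFlag p f a t ≡ wrong
nextFlag-right asking f a t f≢wrong answered-right =
  subst (λ a → ¬ verdict f (isYes a) ≡ wrong) (sym (answered-right refl)) (answer-right f f≢wrong)
nextFlag-right unmarked f a t f≢wrong _ = afterReturn-right t f≢wrong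
nextFlag-right marked f a t f≢wrong _ = afterReturn-right t f≢wrong
nextFlag-right answered f a t f≢wrong _ = afterReturn-right t f≢wrong

isWrong-sound : ∀ s → isWrong s ≡ true → proj₂ s ≡ wrong
isWrong-sound (_ , wrong) _ = refl

-- Player i's strategy: simulate the monitor on the word played so far and answer rightly.
-- It needs unbounded memory, as it must remember where the mark lies in the stack.
answering : ∀ i → Strategy (game i) i
answering i = record
  { next = λ w v → arenaMove (answer (flagAfter (drop 1 (map (label (game i)) (w ∷ʳ v))))) v
  ; legal = λ w v _ → arenaMove-legal i _ v }

-- Every play consistent with the answering strategy is won: by induction, the monitor
-- tracks the play's phase and its flag never becomes wrong.
module Answering (i : Player) (ρ : ℕ → Vtx) (initial : InitialPlay (game i) ρ)
    (consistent : ConsistentWith (game i) (answering i) ρ) where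

  α : ℕ → L
  α = word ρ

  monitor : ℕ → Phase × Flag
  monitor k = proj₁ (MonitorRun.run α k)

  phase-step : ∀ k → proj₁ (ρ (suc k)) ≡ nextPhase (proj₁ (ρ k)) (α k)
  phase-step k = trans (cong proj₁ (Arena.step-det {c = proj₁ (ρ k) , proj₁ (proj₂ (ρ k))} (proj₂ initial k)))
                       (proj₂ (Arena.δ-state _ (α k)))

  answers-rightly : ∀ k → proj₁ (ρ k) ≡ asking → α k ≡ answer (proj₂ (monitor k))
  answers-rightly k asks = begin
      α k
    ≡⟨ cong (label (game i)) (consistent k (subst (λ p → owner i p ≡ i) (sym asks) refl)) ⟩
      answer (flagAfter (drop 1 (map (label (game i)) (prefix (game i) ρ (suc k)))))
    ≡⟨ cong (λ u → answer (flagAfter (drop 1 u))) (prefix-labels (game i) ρ k) ⟩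
      answer (flagAfter (firsts α k))
    ≡⟨ cong (λ c → answer (proj₂ (proj₁ c))) (sym (MonitorRun.run-firsts α k)) ⟩
      answer (proj₂ (monitor k))
    ∎
    where open ≡-Reasoning

  Tracks : ℕ → Set
  Tracks k = proj₁ (monitor k) ≡ proj₁ (ρ k) × ¬ proj₂ (monitor k) ≡ wrong

  tracks : ∀ k → Tracks k
  tracks zero = sym (cong proj₁ (proj₁ initial)) , λ ()
  tracks (suc k) with tracks k | Monitor.δ-state (MonitorRun.run α k) (α k)
  ... | same-phase , f≢wrong | t , state-eq =
    trans (cong proj₁ state-eq) (trans (cong (λ p → nextPhase p (α k)) same-phase) (sym (phase-step k))) ,
    λ is-wrong → nextFlag-right (proj₁ (monitor k)) (proj₂ (monitor k)) (α k) t f≢wrong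
                   (λ asks → answers-rightly k (trans (sym same-phase) asks))
                   (trans (sym (cong proj₂ state-eq)) is-wrong)

  no-mistake : ¬ Sat α 0 mistake
  no-mistake (l , _ , accepting , _) =
    proj₂ (tracks l) (isWrong-sound (monitor l) (MonitorRun.accepting-run accepting))

answering-wins : ∀ i → Winning (game i) (answering i)
answering-wins i ρ initial consistent = wins-without-mistake i ρ (Answering.no-mistake i ρ initial consistent)

trace : Vtx → List L → List Vtx
trace v [] = []
trace v (a ∷ u) = v ∷ trace (arenaMove a v) u

reach : Vtx → List L → Vtx
reach v [] = v
reach v (a ∷ u) = reach (arenaMove a v) u

trace-++ : ∀ v u u' → trace v (u ++ u') ≡ trace v u ++ trace (reach v u) u'
trace-++ v [] u' = refl
trace-++ v (a ∷ u) u' = cong (v ∷_) (trace-++ (arenaMove a v) u u')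

reach-++ : ∀ v u u' → reach v (u ++ u') ≡ reach (reach v u) u'
reach-++ v [] u' = refl
reach-++ v (a ∷ u) u' = reach-++ (arenaMove a v) u u'

trace-labels : ∀ v u → map letterOf (trace v u ∷ʳ reach v u) ≡ letterOf v ∷ u
trace-labels v [] = refl
trace-labels v (a ∷ u) = cong (letterOf v ∷_) (trace-labels (arenaMove a v) u)

Calm : Vtx → Set
Calm v = ¬ proj₁ v ≡ asking

Quiet : L → Set
Quiet a = isQuestion a ≡ false

reach-cfg : ∀ v u → (proj₁ (reach v u) , proj₁ (proj₂ (reach v u))) ≡ foldl Arena.δ (proj₁ v , proj₁ (proj₂ v)) u
reach-cfg v [] = refl
reach-cfg v (a ∷ u) = reach-cfg (arenaMove a v) u

reach-letter : ∀ v u a → letterOf (reach v (u ∷ʳ a)) ≡ a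
reach-letter v [] a = refl
reach-letter v (b ∷ u) a = reach-letter (arenaMove b v) u a

arenaMove-phase : ∀ a v → proj₁ (arenaMove a v) ≡ nextPhase (proj₁ v) a
arenaMove-phase a v = proj₂ (Arena.δ-state _ a)

calm-step : ∀ p a → ¬ p ≡ asking → Quiet a → ¬ nextPhase p a ≡ asking
calm-step unmarked a _ _ with isMark a
... | true = λ ()
... | false = λ ()
calm-step marked a _ quiet rewrite quiet = λ ()
calm-step asking a calm _ = ⊥-elim (calm refl)
calm-step answered a _ _ = λ ()

returns-stay-marked : ∀ k v → proj₁ v ≡ marked → proj₁ (reach v (replicate k lr)) ≡ marked
returns-stay-marked zero v is-marked = is-marked
returns-stay-marked (suc k) v is-marked =
  returns-stay-marked k (arenaMove lr v) (trans (arenaMove-phase lr v) (cong (λ p → nextPhase p lr) is-marked))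

module ArenaRepeat = Repeat Arena.δ
module MonitorRepeat = Repeat Monitor.δ

initialVertex : Vtx
initialVertex = unmarked , [] , le

-- The opponent's probes: j plain calls, the marked call, p plain calls and a local action
-- (so that the vertex reached shows neither j nor p, only the stack height p + 1 + j);
-- then k + 1 returns and the question.  The mark is still pending iff k < p.
opening : ℕ → ℕ → List L
opening j p = (replicate j lc ++ lm ∷ replicate p lc) ∷ʳ le

probe : ℕ → ℕ → ℕ → List L
probe j p k = (opening j p ++ replicate (suc k) lr) ∷ʳ lq

opening-vertex : ∀ j p → reach initialVertex (opening j p) ≡ (marked , replicate (p + suc j) zero , le)
opening-vertex j p = cong₂ (λ c a → proj₁ c , proj₂ c , a) configuration (reach-letter initialVertex (replicate j lc ++ lm ∷ replicate p lc) le)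
  where
  open ≡-Reasoning
  configuration : (proj₁ (reach initialVertex (opening j p)) , proj₁ (proj₂ (reach initialVertex (opening j p))))
                  ≡ (marked , replicate (p + suc j) zero)
  configuration = begin
      _
    ≡⟨ reach-cfg initialVertex (opening j p) ⟩
      foldl Arena.δ (unmarked , []) ((replicate j lc ++ lm ∷ replicate p lc) ∷ʳ le)
    ≡⟨ foldl-∷ʳ Arena.δ _ le (replicate j lc ++ lm ∷ replicate p lc) ⟩
      Arena.δ (foldl Arena.δ (unmarked , []) (replicate j lc ++ lm ∷ replicate p lc)) le
    ≡⟨ cong (λ c → Arena.δ c le) (foldl-++ Arena.δ _ (replicate j lc) (lm ∷ replicate p lc)) ⟩
      Arena.δ (foldl Arena.δ (foldl Arena.δ (unmarked , []) (replicate j lc)) (lm ∷ replicate p lc)) le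
    ≡⟨ cong (λ c → Arena.δ (foldl Arena.δ c (lm ∷ replicate p lc)) le) (ArenaRepeat.repeat-push (λ _ → refl) j []) ⟩
      Arena.δ (foldl Arena.δ (marked , replicate (suc j) zero ++ []) (replicate p lc)) le
    ≡⟨ cong (λ c → Arena.δ c le) (ArenaRepeat.repeat-push (λ _ → refl) p _) ⟩
      (marked , replicate p zero ++ replicate (suc j) zero ++ [])
    ≡⟨ cong (λ γ → marked , replicate p zero ++ γ) (++-identityʳ _) ⟩
      (marked , replicate p zero ++ replicate (suc j) zero)
    ≡⟨ cong (marked ,_) (sym (replicate-+ p (suc j) zero)) ⟩
      (marked , replicate (p + suc j) zero)
    ∎

monitor-probe : ∀ j p k → foldl Monitor.δ monitorStart (probe j p k)
                ≡ foldl Monitor.δ ((marked , pending) , replicate p plain ++ mark ∷ replicate j plain ++ [])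
                                  (replicate (suc k) lr ++ lq ∷ [])
monitor-probe j p k = begin
    foldl Monitor.δ monitorStart ((opening j p ++ returns) ++ lq ∷ [])
  ≡⟨ cong (foldl Monitor.δ monitorStart) (++-assoc (opening j p) returns (lq ∷ [])) ⟩
    foldl Monitor.δ monitorStart (opening j p ++ returns ++ lq ∷ [])
  ≡⟨ foldl-++ Monitor.δ monitorStart (opening j p) (returns ++ lq ∷ []) ⟩
    foldl Monitor.δ (foldl Monitor.δ monitorStart (opening j p)) (returns ++ lq ∷ [])
  ≡⟨ cong (λ c → foldl Monitor.δ c (returns ++ lq ∷ [])) opened ⟩
    foldl Monitor.δ ((marked , pending) , replicate p plain ++ mark ∷ replicate j plain ++ []) (returns ++ lq ∷ [])
  ∎
  where
  open ≡-Reasoning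
  returns = replicate (suc k) lr
  opened : foldl Monitor.δ monitorStart (opening j p) ≡ ((marked , pending) , replicate p plain ++ mark ∷ replicate j plain ++ [])
  opened = begin
      foldl Monitor.δ monitorStart ((replicate j lc ++ lm ∷ replicate p lc) ∷ʳ le)
    ≡⟨ foldl-∷ʳ Monitor.δ _ le (replicate j lc ++ lm ∷ replicate p lc) ⟩
      Monitor.δ (foldl Monitor.δ monitorStart (replicate j lc ++ lm ∷ replicate p lc)) le
    ≡⟨ cong (λ c → Monitor.δ c le) (foldl-++ Monitor.δ _ (replicate j lc) (lm ∷ replicate p lc)) ⟩
      Monitor.δ (foldl Monitor.δ (foldl Monitor.δ monitorStart (replicate j lc)) (lm ∷ replicate p lc)) le
    ≡⟨ cong (λ c → Monitor.δ (foldl Monitor.δ c (lm ∷ replicate p lc)) le) (MonitorRepeat.repeat-push (λ _ → refl) j []) ⟩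
      Monitor.δ (foldl Monitor.δ ((marked , pending) , mark ∷ replicate j plain ++ []) (replicate p lc)) le
    ≡⟨ cong (λ c → Monitor.δ c le) (MonitorRepeat.repeat-push (λ _ → refl) p _) ⟩
      ((marked , pending) , replicate p plain ++ mark ∷ replicate j plain ++ [])
    ∎

probe-pending : ∀ j k o → ∃ λ γ → foldl Monitor.δ monitorStart (probe j (suc k + o) k) ≡ ((asking , pending) , γ)
probe-pending j k o = _ , (begin
    foldl Monitor.δ monitorStart (probe j (suc k + o) k)
  ≡⟨ monitor-probe j (suc k + o) k ⟩
    foldl Monitor.δ ((marked , pending) , replicate (suc k + o) plain ++ below) (replicate (suc k) lr ++ lq ∷ [])
  ≡⟨ cong (λ γ → foldl Monitor.δ ((marked , pending) , γ) (replicate (suc k) lr ++ lq ∷ [])) split ⟩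
    foldl Monitor.δ ((marked , pending) , replicate (suc k) plain ++ replicate o plain ++ below) (replicate (suc k) lr ++ lq ∷ [])
  ≡⟨ MonitorRepeat.repeat-pop {s = marked , pending} {a = lr} (λ _ → refl) (suc k) _ (lq ∷ []) ⟩
    ((asking , pending) , replicate o plain ++ below)
  ∎)
  where
  open ≡-Reasoning
  below = mark ∷ replicate j plain ++ []
  split : replicate (suc k + o) plain ++ below ≡ replicate (suc k) plain ++ replicate o plain ++ below
  split = trans (cong (_++ below) (replicate-+ (suc k) o plain)) (++-assoc (replicate (suc k) plain) _ below)

probe-popped : ∀ j k → ∃ λ γ → foldl Monitor.δ monitorStart (probe j k k) ≡ ((asking , popped) , γ)
probe-popped j k = _ , (begin
    foldl Monitor.δ monitorStart (probe j k k)
  ≡⟨ monitor-probe j k k ⟩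
    foldl Monitor.δ ((marked , pending) , replicate k plain ++ below) (lr ∷ replicate k lr ++ lq ∷ [])
  ≡⟨ cong (foldl Monitor.δ ((marked , pending) , replicate k plain ++ below)) (sym (replicate-shift k lr (lq ∷ []))) ⟩
    foldl Monitor.δ ((marked , pending) , replicate k plain ++ below) (replicate k lr ++ lr ∷ lq ∷ [])
  ≡⟨ MonitorRepeat.repeat-pop {s = marked , pending} {a = lr} (λ _ → refl) k below (lr ∷ lq ∷ []) ⟩
    ((asking , popped) , replicate j plain ++ [])
  ∎)
  where
  open ≡-Reasoning
  below = mark ∷ replicate j plain ++ []

verdict-decisive : ∀ b → verdict pending b ≡ wrong ⊎ verdict popped b ≡ wrong
verdict-decisive false = inj₁ refl
verdict-decisive true = inj₂ refl

gap : ∀ p₁ p₂ j₁ j₂ → p₁ + j₁ ≡ p₂ + j₂ → j₁ < j₂ → ∃ λ o → p₁ ≡ suc p₂ + o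
gap p₁ p₂ j₁ j₂ same j₁<j₂ with m≤n⇒∃[o]m+o≡n j₁<j₂
... | o , refl = o , +-cancelʳ-≡ j₁ p₁ (suc p₂ + o) (trans same (rearrange p₂ j₁ o))
  where
  rearrange : ∀ p j o → p + (suc j + o) ≡ suc p + o + j
  rearrange = solve-∀

-- A finite-memory strategy of Player i cannot be winning: its memory cannot tell apart two
-- openings with the same stack height, one with more and one with fewer plain calls above
-- the mark than the returns that follow; it answers both identically, and errs in one.
module FiniteMemoryLoses (i : Player) (σ : Strategy (game i) i) (winning : Winning (game i) σ)
    (size : ℕ) (init : Fin size) (update : Fin size → Vtx → Fin size) (out : Fin size → Vtx → Vtx)
    (implements : ∀ w v → vOwner (game i) v ≡ i → next σ w v ≡ out (foldl update init w) v) where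

  open Outcome (game i) σ arenaMove (λ a v _ → arenaMove-legal i a v)

  follow : ∀ u a w v → Calm v → All Quiet u →
           foldl advance (w , v) (u ∷ʳ a) ≡ (w ++ trace v (u ∷ʳ a) , reach v (u ∷ʳ a))
  follow [] a w v calm [] = advance-env a (λ owned → calm (owned-is-asking i _ owned))
  follow (b ∷ u) a w v calm (quiet ∷ quiets) = begin
      foldl advance (advance (w , v) b) (u ∷ʳ a)
    ≡⟨ cong (λ p → foldl advance p (u ∷ʳ a)) (advance-env b (λ owned → calm (owned-is-asking i _ owned))) ⟩
      foldl advance (w ∷ʳ v , arenaMove b v) (u ∷ʳ a)
    ≡⟨ follow u a (w ∷ʳ v) (arenaMove b v) calm' quiets ⟩
      ((w ∷ʳ v) ++ trace (arenaMove b v) (u ∷ʳ a) , reach v (b ∷ u ∷ʳ a))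
    ≡⟨ cong (_, reach v (b ∷ u ∷ʳ a)) (++-assoc w (v ∷ []) _) ⟩
      (w ++ trace v (b ∷ u ∷ʳ a) , reach v (b ∷ u ∷ʳ a))
    ∎
    where
    open ≡-Reasoning
    calm' : Calm (arenaMove b v)
    calm' = subst (λ p → ¬ p ≡ asking) (sym (arenaMove-phase b v)) (calm-step (proj₁ v) b calm quiet)

  caught : ∀ u a → All Quiet u → proj₁ (reach initialVertex (u ∷ʳ a)) ≡ asking →
           ∀ f γ → foldl Monitor.δ monitorStart (u ∷ʳ a) ≡ ((asking , f) , γ) →
           verdict f (isYes (letterOf (next σ (trace initialVertex (u ∷ʳ a)) (reach initialVertex (u ∷ʳ a))))) ≡ wrong →
           ⊥
  caught u a quiets asks f γ question wrong-answer =
    wins-only-without-mistake i ρ (play-won winning script)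
      (suc ℓ , z≤n , MonitorRun.run-accepts _ (λ _ k → truth-holds α k) α (suc ℓ) rejected , truth-holds α (suc ℓ))
    where
    open ≡-Reasoning
    w = u ∷ʳ a
    ℓ = length w
    script = padded le w
    ρ = play script
    α = word ρ
    H = trace initialVertex w
    A = reach initialVertex w
    N = next σ H A
    at-question : position script ℓ ≡ (H , A)
    at-question = trans (cong (foldl advance ([] , vI (game i))) (firsts-padded le w))
                        (follow u a [] initialVertex (λ ()) quiets)
    at-answer : position script (suc ℓ) ≡ (H ∷ʳ A , N)
    at-answer = trans (position-suc script ℓ)
                     (trans (cong (λ p → advance p (script ℓ)) at-question)
                            (advance-σ (script ℓ) (subst (λ p → owner i p ≡ i) (sym asks) refl)))
    recorded : firsts α (suc ℓ) ≡ w ∷ʳ letterOf N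
    recorded = ∷-injectiveʳ (begin
        letterOf initialVertex ∷ firsts α (suc ℓ)
      ≡⟨ sym (prefix-labels (game i) ρ (suc ℓ)) ⟩
        map letterOf (prefix (game i) ρ (suc (suc ℓ)))
      ≡⟨ cong (map letterOf) (sym (history-is-prefix script (suc (suc ℓ)))) ⟩
        map letterOf (proj₁ (position script (suc (suc ℓ))))
      ≡⟨ cong (λ p → map letterOf (proj₁ p)) (position-suc script (suc ℓ)) ⟩
        map letterOf (proj₁ (position script (suc ℓ)) ∷ʳ ρ (suc ℓ))
      ≡⟨ cong (λ p → map letterOf (proj₁ p ∷ʳ proj₂ p)) at-answer ⟩
        map letterOf ((H ∷ʳ A) ∷ʳ N)
      ≡⟨ map-++ letterOf (H ∷ʳ A) (N ∷ []) ⟩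
        map letterOf (H ∷ʳ A) ∷ʳ letterOf N
      ≡⟨ cong (_∷ʳ letterOf N) (trace-labels initialVertex w) ⟩
        letterOf initialVertex ∷ w ∷ʳ letterOf N
      ∎)
    rejected : isWrong (proj₁ (MonitorRun.run α (suc ℓ))) ≡ true
    rejected with Monitor.δ-state ((asking , f) , γ) (letterOf N)
    ... | t , after-answer = begin
        isWrong (proj₁ (MonitorRun.run α (suc ℓ)))
      ≡⟨ cong (λ c → isWrong (proj₁ c)) (trans (MonitorRun.run-firsts α (suc ℓ)) (cong (foldl Monitor.δ monitorStart) recorded)) ⟩
        isWrong (proj₁ (foldl Monitor.δ monitorStart (w ∷ʳ letterOf N)))
      ≡⟨ cong (λ c → isWrong (proj₁ c)) (trans (foldl-∷ʳ Monitor.δ monitorStart (letterOf N) w)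
                                              (cong (λ c → Monitor.δ c (letterOf N)) question)) ⟩
        isWrong (proj₁ (Monitor.δ ((asking , f) , γ) (letterOf N)))
      ≡⟨ cong isWrong after-answer ⟩
        isWrong (answered , verdict f (isYes (letterOf N)))
      ≡⟨ cong (λ g → isWrong (answered , g)) wrong-answer ⟩
        true
      ∎

  memoryAfter : ℕ → ℕ → Fin size
  memoryAfter j p = foldl update init (trace initialVertex (opening j p))

  opened : ℕ → Vtx
  opened h = marked , replicate h zero , le

  continuation : ℕ → List L
  continuation k = replicate (suc k) lr ∷ʳ lq

  reply : ℕ → ℕ → Fin size → L
  reply h k mem = letterOf (out (foldl update mem (trace (opened h) (continuation k))) (reach (opened h) (continuation k)))

  probe-split : ∀ j p k → probe j p k ≡ opening j p ++ continuation k
  probe-split j p k = ++-assoc (opening j p) (replicate (suc k) lr) (lq ∷ [])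

  probe-quiet : ∀ j p k → All Quiet (opening j p ++ replicate (suc k) lr)
  probe-quiet j p k = ++⁺ (++⁺ (++⁺ (replicate⁺ j refl) (refl ∷ replicate⁺ p refl)) (refl ∷ [])) (replicate⁺ (suc k) refl)

  probe-asks : ∀ j p k → proj₁ (reach initialVertex (probe j p k)) ≡ asking
  probe-asks j p k = begin
      proj₁ (reach initialVertex ((opening j p ++ replicate (suc k) lr) ∷ʳ lq))
    ≡⟨ cong proj₁ (reach-++ initialVertex (opening j p ++ replicate (suc k) lr) (lq ∷ [])) ⟩
      proj₁ (arenaMove lq (reach initialVertex (opening j p ++ replicate (suc k) lr)))
    ≡⟨ arenaMove-phase lq (reach initialVertex (opening j p ++ replicate (suc k) lr)) ⟩
      nextPhase (proj₁ (reach initialVertex (opening j p ++ replicate (suc k) lr))) lq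
    ≡⟨ cong (λ v → nextPhase (proj₁ v) lq) (reach-++ initialVertex (opening j p) (replicate (suc k) lr)) ⟩
      nextPhase (proj₁ (reach (reach initialVertex (opening j p)) (replicate (suc k) lr))) lq
    ≡⟨ cong (λ p → nextPhase p lq) (returns-stay-marked (suc k) (reach initialVertex (opening j p)) (cong proj₁ (opening-vertex j p))) ⟩
      asking
    ∎
    where open ≡-Reasoning

  answer-is-reply : ∀ j p k → letterOf (next σ (trace initialVertex (probe j p k)) (reach initialVertex (probe j p k)))
                              ≡ reply (p + suc j) k (memoryAfter j p)
  answer-is-reply j p k = begin
      letterOf (next σ (trace initialVertex (probe j p k)) (reach initialVertex (probe j p k)))
    ≡⟨ cong letterOf (implements _ _ (subst (λ q → owner i q ≡ i) (sym (probe-asks j p k)) refl)) ⟩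
      letterOf (out (foldl update init (trace initialVertex (probe j p k))) (reach initialVertex (probe j p k)))
    ≡⟨ cong (λ u → letterOf (out (foldl update init (trace initialVertex u)) (reach initialVertex u))) (probe-split j p k) ⟩
      letterOf (out (foldl update init (trace initialVertex (opening j p ++ continuation k)))
                    (reach initialVertex (opening j p ++ continuation k)))
    ≡⟨ cong₂ (λ H A → letterOf (out (foldl update init H) A))
             (trace-++ initialVertex (opening j p) (continuation k)) (reach-++ initialVertex (opening j p) (continuation k)) ⟩
      letterOf (out (foldl update init (trace initialVertex (opening j p) ++ trace v₁ (continuation k))) (reach v₁ (continuation k)))
    ≡⟨ cong (λ mem → letterOf (out mem (reach v₁ (continuation k))))
            (foldl-++ update init (trace initialVertex (opening j p)) (trace v₁ (continuation k))) ⟩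
      letterOf (out (foldl update (memoryAfter j p) (trace v₁ (continuation k))) (reach v₁ (continuation k)))
    ≡⟨ cong (λ v → letterOf (out (foldl update (memoryAfter j p) (trace v (continuation k))) (reach v (continuation k))))
            (opening-vertex j p) ⟩
      reply (p + suc j) k (memoryAfter j p)
    ∎
    where
    open ≡-Reasoning
    v₁ = reach initialVertex (opening j p)

  caught-at-probe : ∀ j p k f → (∃ λ γ → foldl Monitor.δ monitorStart (probe j p k) ≡ ((asking , f) , γ)) →
                    verdict f (isYes (reply (p + suc j) k (memoryAfter j p))) ≡ wrong → ⊥
  caught-at-probe j p k f (γ , question) wrong-reply =
    caught (opening j p ++ replicate (suc k) lr) lq (probe-quiet j p k) (probe-asks j p k) f γ question
           (subst (λ a → verdict f (isYes a) ≡ wrong) (sym (answer-is-reply j p k)) wrong-reply)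

  indistinguishable : ∀ j₁ p₁ j₂ p₂ → p₁ + j₁ ≡ p₂ + j₂ → j₁ < j₂ → memoryAfter j₁ p₁ ≡ memoryAfter j₂ p₂ → ⊥
  indistinguishable j₁ p₁ j₂ p₂ same-height j₁<j₂ same-memory
    with o , more-calls ← gap p₁ p₂ j₁ j₂ same-height j₁<j₂
    with verdict-decisive (isYes (reply (p₂ + suc j₂) p₂ (memoryAfter j₂ p₂)))
  ... | inj₁ pending-wrong =
    caught-at-probe j₁ p₁ p₂ pending
      (subst (λ p → ∃ λ γ → foldl Monitor.δ monitorStart (probe j₁ p p₂) ≡ ((asking , pending) , γ))
             (sym more-calls) (probe-pending j₁ p₂ o))
      (subst (λ a → verdict pending (isYes a) ≡ wrong) (sym same-reply) pending-wrong)
    where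
    same-reply : reply (p₁ + suc j₁) p₂ (memoryAfter j₁ p₁) ≡ reply (p₂ + suc j₂) p₂ (memoryAfter j₂ p₂)
    same-reply = cong₂ (λ h mem → reply h p₂ mem)
                       (trans (+-suc p₁ j₁) (trans (cong suc same-height) (sym (+-suc p₂ j₂)))) same-memory
  ... | inj₂ popped-wrong = caught-at-probe j₂ p₂ p₂ popped (probe-popped j₂ p₂) popped-wrong

  -- By the pigeonhole principle, some two of the size + 1 openings of height size + 1 share
  -- their memory state.
  impossible : ⊥
  impossible with t₁ , t₂ , t₁<t₂ , same-memory ← pigeonhole (n<1+n size) (λ t → memoryAfter (toℕ t) (size ∸ toℕ t)) =
    indistinguishable (toℕ t₁) (size ∸ toℕ t₁) (toℕ t₂) (size ∸ toℕ t₂) (trans (fills t₁) (sym (fills t₂))) t₁<t₂ same-memory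
    where
    fills : ∀ t → size ∸ toℕ t + toℕ t ≡ size
    fills t = m∸n+n≡m (toℕ≤pred[n] t)

only-with-infinite-memory : ∀ i → WinsOnlyWithInfiniteMemory (game i) i
only-with-infinite-memory i =
  (answering i , answering-wins i) ,
  λ σ winning (size , init , update , out , implements) →
    FiniteMemoryLoses.impossible i σ winning size init update out implements

corollary1 : (Σ ℕ λ n → Σ (Letter n → Kind) λ kind → Σ (VPGame n kind) λ G → WinsOnlyWithInfiniteMemory G P0)
             × (Σ ℕ λ n → Σ (Letter n → Kind) λ kind → Σ (VPGame n kind) λ G → WinsOnlyWithInfiniteMemory G P1)
corollary1 = (3 , kind₃ , game P0 , only-with-infinite-memory P0) , (3 , kind₃ , game P1 , only-with-infinite-memory P1)
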